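{- For every $n\geq 3$ and every positive integer $r$, $\operatorname{im}(C_n\circ K_r)=3r$.
   Context: All graphs are finite and simple; $C_n$ is the cycle on $n$ vertices and $K_r$ the complete graph on $r$ vertices. A graph $G$ has a $G'$-immersion if there is an injective map $\phi:V(G')\to V(G)$ such that for every edge $uv\in E(G')$ there is a path in $G$ joining $\phi(u)$ and $\phi(v)$, and these paths are pairwise edge-disjoint. The immersion number $\operatorname{im}(G)$ is the largest $t$ such that $G$ has a $K_t$-immersion. The lexicographic product $G\circ H$ has vertex set $V(G)\times V(H)$, with $(g,h)$ adjacent to $(g',h')$ iff $gg'\in E(G)$, or $g=g'$ and $hh'\in E(H)$. -}

module Defs where

open import Data.Nat using (ℕ; zero; suc; _+_; _*_; _≤_)
open import Data.Fin using (Fin; toℕ; _<_)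
open import Data.Product using (Σ; _×_; _,_; proj₁; proj₂)
open import Data.Sum using (_⊎_)
open import Data.Empty using (⊥)
open import Data.List using (List; []; _∷_)
open import Data.List.Membership.Propositional using (_∈_)
open import Data.List.Relation.Unary.Unique.Propositional using (Unique)
open import Relation.Binary.PropositionalEquality using (_≡_; _≢_)
open import Relation.Nullary using (¬_)
open import Function.Definitions using (Injective)

-- A (simple) graph: a vertex type with an adjacency relation.
-- All concrete graphs below are finite, with symmetric irreflexive adjacency.
record Graph : Set₁ where
  field
    V   : Set
    Adj : V → V → Set
open Graph public

-- Cycle C_n on vertex set Fin n = {0,…,n-1}: i ~ j iff they are consecutive
-- (|i - j| = 1) or {i,j} = {0, n-1}.  (Simple for n ≥ 3, the only case used.)
CycleAdj : (n : ℕ) → ℕ → ℕ → Set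
CycleAdj n a b = (suc a ≡ b) ⊎ (a ≡ 0 × suc b ≡ n)

Cycle : ℕ → Graph
Cycle n = record
  { V   = Fin n
  ; Adj = λ i j → CycleAdj n (toℕ i) (toℕ j) ⊎ CycleAdj n (toℕ j) (toℕ i)
  }

Complete : ℕ → Graph
Complete r = record { V = Fin r ; Adj = λ i j → i ≢ j }

Lex : Graph → Graph → Graph
Lex G H = record
  { V   = V G × V H
  ; Adj = λ { (g , h) (g' , h') → Adj G g g' ⊎ (g ≡ g' × Adj H h h') }
  }

data Walk (G : Graph) : V G → V G → Set where
  [] : ∀ {u} → Walk G u u
  _∷_ : ∀ {u w v} → Adj G u w → Walk G w v → Walk G u v

vertices : ∀ {G u v} → Walk G u v → List (V G)
vertices {u = u} []      = u ∷ []
vertices {u = u} (_ ∷ p) = u ∷ vertices p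

edges : ∀ {G u v} → Walk G u v → List (V G × V G)
edges []                    = []
edges {u = u} (_∷_ {w = w} _ p) = (u , w) ∷ edges p

Path : (G : Graph) → V G → V G → Set
Path G u v = Σ (Walk G u v) λ p → Unique (vertices p)

EdgeDisjoint : ∀ {G u v u' v'} → Path G u v → Path G u' v' → Set
EdgeDisjoint {G} (p , _) (q , _) =
  ∀ (a b : V G) → (a , b) ∈ edges p → ((a , b) ∈ edges q ⊎ (b , a) ∈ edges q) → ⊥

record KImmersion (G : Graph) (t : ℕ) : Set where
  field
    φ     : Fin t → V G
    φ-inj : Injective _≡_ _≡_ φ
    path  : (i j : Fin t) → i < j → Path G (φ i) (φ j)
    disj  : ∀ (i j k l : Fin t) (ij : i < j) (kl : k < l) →
            ¬ (i ≡ k × j ≡ l) → EdgeDisjoint (path i j ij) (path k l kl)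

ImmersionNumber : Graph → ℕ → Set
ImmersionNumber G t = KImmersion G t × (∀ s → KImmersion G s → s ≤ t)

module Submission where

-- In a K_s-immersion the s - 1 paths leaving the image of one
-- branch vertex are edge-disjoint, so their first edges reach s - 1 distinct
-- neighbours: im(G) ≤ Δ(G) + 1.  Degree bounds are expressed as injective
-- "neighbour codes" into Fin d; they are inherited by lexicographic products,
-- which gives Δ(C_n ∘ K_r) ≤ 2r + (r - 1).
--
-- Put r branch vertices on each of the layers 0, N = n - 2 and
-- N + 1 = n - 1 of the cycle.  Pairs inside a layer are joined by a K_r edge,
-- pairs in the adjacent layers (N, N+1) and (N+1, 0) by a single edge, and a
-- pair (a in layer 0, c in layer N) by a path climbing layers 0, 1, …, N whose
-- K_r-coordinates form a "route" from a to c in which every step determines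
-- (a, c).  Edge-disjointness is certified by a labelling of vertex pairs: every
-- path carries its unordered pair of ends as the label of all its edges.

open import Defs
open import Data.Nat
  using (ℕ; zero; suc; _+_; _*_; _∸_; _≤_; _<_; _⊓_; _⊔_; z≤n; s≤s; NonZero; _≤‴_; ≤‴-refl; ≤‴-step)
import Data.Nat as ℕ
open import Data.Nat.Properties
  using (suc-injective; 0≢1+n; 1+n≰n; <-irrefl; <-asym; ≤-reflexive; ≤-trans; ≤-<-trans; <⇒≤; n≤1+n; n<1+n; ≰⇒>;
         ≤-total; m≤n⇒m⊓n≡m; m≥n⇒m⊓n≡n; m≤n⇒m⊔n≡n; m≥n⇒m⊔n≡m; ⊓-comm; ⊔-comm; +-suc; +-comm; +-assoc;
         m+[n∸m]≡n; ≤‴⇒≤; ≤⇒≤‴)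
open import Data.Nat.DivMod using (_%_; _mod_; %-distribˡ-+; m%n%n≡m%n; [m+n]%n≡m%n; m<n⇒m%n≡m)
open import Data.Fin using (Fin; toℕ; fromℕ<; punchOut; join; splitAt; combine; remQuot; quotient; remainder)
import Data.Fin as Fin
open import Data.Fin.Patterns using (0F; 1F; 2F)
open import Data.Fin.Properties
  using (toℕ-injective; toℕ<n; toℕ-fromℕ<; splitAt-join; combine-injective; combine-remQuot; combine-monoˡ-<;
         punchOut-injective; injective⇒≤; <⇒≢; _≟_)
  renaming (0≢1+n to zero≢suc; suc-injective to Fin-suc-injective)
open import Data.Product using (Σ; _×_; _,_; proj₁; proj₂; uncurry)
open import Data.Sum using (_⊎_; inj₁; inj₂; [_,_]′)
open import Data.Sum.Properties using (inj₁-injective; inj₂-injective)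
open import Data.Empty using (⊥-elim)
open import Data.List.Membership.Propositional using (_∈_)
open import Data.List.Relation.Unary.Any using (here)
open import Data.List.Relation.Unary.All using (All; []; _∷_)
import Data.List.Relation.Unary.All as All
open import Data.List.Relation.Unary.AllPairs using ([]; _∷_)
open import Data.List.Relation.Unary.Unique.Propositional using (Unique)
open import Function using (_∘_; id)
open import Function.Definitions using (Injective)
open import Relation.Binary.PropositionalEquality
open import Relation.Nullary using (¬_; Dec; yes; no; contradiction)
open import Relation.Nullary.Decidable using (_×-dec_)

firstEdge : ∀ {G u v} (p : Walk G u v) → u ≢ v →
            Σ (V G) λ w → Adj G u w × (u , w) ∈ edges p
firstEdge []      u≢u = ⊥-elim (u≢u refl)
firstEdge (a ∷ _) _   = _ , a , here refl

-- Maximum degree at most d, witnessed by an injective coding of the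
-- neighbours of every vertex by Fin d.
record NeighbourCode (G : Graph) (d : ℕ) : Set where
  field
    code      : ∀ u w → Adj G u w → Fin d
    injective : ∀ u {w w'} (a : Adj G u w) (a' : Adj G u w') →
                code u w a ≡ code u w' a' → w ≡ w'

-- im(G) ≤ Δ(G) + 1: the paths from branch vertex 0 to the other branch
-- vertices are edge-disjoint, so their first edges reach distinct neighbours.
immersion≤degree : ∀ {G d s} → NeighbourCode G d → KImmersion G s → s ≤ suc d
immersion≤degree {s = zero}            _  _ = z≤n
immersion≤degree {G} {d} {suc s} nc K = s≤s (injective⇒≤ {f = firstCode} firstCode-injective)
  where
  open KImmersion K
  open NeighbourCode nc

  out : (j : Fin s) → Walk G (φ 0F) (φ (Fin.suc j))
  out j = proj₁ (path 0F (Fin.suc j) (s≤s z≤n))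

  first : (j : Fin s) → Σ (V G) λ w → Adj G (φ 0F) w × (φ 0F , w) ∈ edges (out j)
  first j = firstEdge (out j) (λ e → zero≢suc (φ-inj e))

  firstCode : Fin s → Fin d
  firstCode j = code (φ 0F) _ (proj₁ (proj₂ (first j)))

  firstCode-injective : Injective _≡_ _≡_ firstCode
  firstCode-injective {j} {k} e with j ≟ k
  ... | yes j≡k = j≡k
  ... | no  j≢k = ⊥-elim (disj 0F (Fin.suc j) 0F (Fin.suc k) _ _ (j≢k ∘ Fin-suc-injective ∘ proj₂)
                                (φ 0F) _ (proj₂ (proj₂ (first j))) (inj₁ firstOfK))
    where
    sameNeighbour : proj₁ (first j) ≡ proj₁ (first k)
    sameNeighbour = injective (φ 0F) _ _ e

    firstOfK : (φ 0F , proj₁ (first j)) ∈ edges (out k)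
    firstOfK = subst (λ w → (φ 0F , w) ∈ edges (out k)) (sym sameNeighbour) (proj₂ (proj₂ (first k)))

Successor : ℕ → ℕ → ℕ → Set
Successor n a b = suc a ≡ b ⊎ (b ≡ 0 × suc a ≡ n)

cycle-direction : ∀ {n} {i j : Fin n} → Adj (Cycle n) i j →
                  Successor n (toℕ i) (toℕ j) ⊎ Successor n (toℕ j) (toℕ i)
cycle-direction (inj₁ (inj₁ i+1≡j))        = inj₁ (inj₁ i+1≡j)
cycle-direction (inj₁ (inj₂ (i≡0 , j+1≡n))) = inj₂ (inj₂ (i≡0 , j+1≡n))
cycle-direction (inj₂ (inj₁ j+1≡i))        = inj₂ (inj₁ j+1≡i)
cycle-direction (inj₂ (inj₂ (j≡0 , i+1≡n))) = inj₁ (inj₂ (j≡0 , i+1≡n))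

successor-unique : ∀ {n a b b'} → b < n → b' < n → Successor n a b → Successor n a b' → b ≡ b'
successor-unique _   _    (inj₁ e)       (inj₁ e')       = trans (sym e) e'
successor-unique b<n _    (inj₁ e)       (inj₂ (_ , e')) = ⊥-elim (<-irrefl (trans (sym e) e') b<n)
successor-unique _   b'<n (inj₂ (_ , e)) (inj₁ e')       = ⊥-elim (<-irrefl (trans (sym e') e) b'<n)
successor-unique _   _    (inj₂ (z , _)) (inj₂ (z' , _)) = trans z (sym z')

predecessor-unique : ∀ {n a a' b} → Successor n a b → Successor n a' b → a ≡ a'
predecessor-unique (inj₁ e)       (inj₁ e')       = suc-injective (trans e (sym e'))
predecessor-unique (inj₁ e)       (inj₂ (z , _))  = ⊥-elim (0≢1+n (trans (sym z) (sym e)))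
predecessor-unique (inj₂ (z , _)) (inj₁ e')       = ⊥-elim (0≢1+n (trans (sym z) (sym e')))
predecessor-unique (inj₂ (_ , e)) (inj₂ (_ , e')) = suc-injective (trans e (sym e'))

cycleCode : ∀ n → NeighbourCode (Cycle n) 2
cycleCode n = record { code = λ _ _ a → side (cycle-direction a) ; injective = injective }
  where
  side : ∀ {A B : Set} → A ⊎ B → Fin 2
  side = [ (λ _ → 0F) , (λ _ → 1F) ]′

  injective : ∀ (i : Fin n) {j j'} (a : Adj (Cycle n) i j) (a' : Adj (Cycle n) i j') →
              side (cycle-direction a) ≡ side (cycle-direction a') → j ≡ j'
  injective i {j} {j'} a a' e with cycle-direction a | cycle-direction a'
  ... | inj₁ s | inj₁ s' = toℕ-injective (successor-unique (toℕ<n j) (toℕ<n j') s s')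
  ... | inj₂ s | inj₂ s' = toℕ-injective (predecessor-unique s s')
  ... | inj₁ _ | inj₂ _  = contradiction e λ ()
  ... | inj₂ _ | inj₁ _  = contradiction e λ ()

completeCode : ∀ r' → NeighbourCode (Complete (suc r')) r'
completeCode r' = record { code = λ _ _ i≢j → punchOut i≢j ; injective = λ _ → punchOut-injective }

join-injective : ∀ m n {x y : Fin m ⊎ Fin n} → join m n x ≡ join m n y → x ≡ y
join-injective m n {x} {y} e = trans (sym (splitAt-join m n x)) (trans (cong (splitAt m) e) (splitAt-join m n y))

-- Δ(G ∘ H) ≤ Δ(G) |H| + Δ(H): a neighbour (g', h') of (g, h) is coded by the
-- pair (code of g', index of h') if g' ~ g, and by the code of h' if g' = g.
lexCode : ∀ {G H d e k} → NeighbourCode G d → NeighbourCode H e →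
          (index : V H → Fin k) → Injective _≡_ _≡_ index → NeighbourCode (Lex G H) (d * k + e)
lexCode {G} {H} {d} {e} {k} cG cH index index-injective = record { code = code ; injective = injective }
  where
  module CG = NeighbourCode cG
  module CH = NeighbourCode cH

  code⊎ : ∀ u w → Adj (Lex G H) u w → Fin (d * k) ⊎ Fin e
  code⊎ (g , _) (g' , h') (inj₁ a)       = inj₁ (combine (CG.code g g' a) (index h'))
  code⊎ (_ , h) (_  , h') (inj₂ (_ , b)) = inj₂ (CH.code h h' b)

  code : ∀ u w → Adj (Lex G H) u w → Fin (d * k + e)
  code u w a = join (d * k) e (code⊎ u w a)

  injective⊎ : ∀ u {w w'} (a : Adj (Lex G H) u w) (a' : Adj (Lex G H) u w') → code⊎ u w a ≡ code⊎ u w' a' → w ≡ w'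
  injective⊎ (g , _) (inj₁ a) (inj₁ a') c≡c' with combine-injective _ _ _ _ (inj₁-injective c≡c')
  ... | g-code≡ , index≡ = cong₂ _,_ (CG.injective g a a' g-code≡) (index-injective index≡)
  injective⊎ (g , h) (inj₂ (refl , b)) (inj₂ (refl , b')) c≡c' = cong (g ,_) (CH.injective h b b' (inj₂-injective c≡c'))
  injective⊎ _ (inj₁ _) (inj₂ _) ()
  injective⊎ _ (inj₂ _) (inj₁ _) ()

  injective : ∀ u {w w'} (a : Adj (Lex G H) u w) (a' : Adj (Lex G H) u w') → code u w a ≡ code u w' a' → w ≡ w'
  injective u a a' = injective⊎ u a a' ∘ join-injective (d * k) e

-- im(C_n ∘ K_r) ≤ Δ + 1 ≤ 2r + (r - 1) + 1 = 3r.
cycleLex-bound : ∀ n r' s → KImmersion (Lex (Cycle n) (Complete (suc r'))) s → s ≤ 3 * suc r'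
cycleLex-bound n r' s K = subst (s ≤_) degree+1≡3r (immersion≤degree (lexCode (cycleCode n) (completeCode r') id id) K)
  where
  r = suc r'
  degree+1≡3r : suc (2 * r + r') ≡ 3 * r
  degree+1≡3r = begin
    suc (2 * r + r') ≡⟨ sym (+-suc (2 * r) r') ⟩
    2 * r + r        ≡⟨ +-comm (2 * r) r ⟩
    3 * r            ∎
    where open ≡-Reasoning

minmax-injective : ∀ {a b c d} → a ⊓ b ≡ c ⊓ d → a ⊔ b ≡ c ⊔ d → (a ≡ c × b ≡ d) ⊎ (a ≡ d × b ≡ c)
minmax-injective {a} {b} {c} {d} min≡ max≡ with ≤-total a b | ≤-total c d
... | inj₁ a≤b | inj₁ c≤d = inj₁ (subst₂ _≡_ (m≤n⇒m⊓n≡m a≤b) (m≤n⇒m⊓n≡m c≤d) min≡ ,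
                                 subst₂ _≡_ (m≤n⇒m⊔n≡n a≤b) (m≤n⇒m⊔n≡n c≤d) max≡)
... | inj₁ a≤b | inj₂ d≤c = inj₂ (subst₂ _≡_ (m≤n⇒m⊓n≡m a≤b) (m≥n⇒m⊓n≡n d≤c) min≡ ,
                                 subst₂ _≡_ (m≤n⇒m⊔n≡n a≤b) (m≥n⇒m⊔n≡m d≤c) max≡)
... | inj₂ b≤a | inj₁ c≤d = inj₂ (subst₂ _≡_ (m≥n⇒m⊔n≡m b≤a) (m≤n⇒m⊔n≡n c≤d) max≡ ,
                                 subst₂ _≡_ (m≥n⇒m⊓n≡n b≤a) (m≤n⇒m⊓n≡m c≤d) min≡)
... | inj₂ b≤a | inj₂ d≤c = inj₁ (subst₂ _≡_ (m≥n⇒m⊔n≡m b≤a) (m≥n⇒m⊔n≡m d≤c) max≡ ,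
                                 subst₂ _≡_ (m≥n⇒m⊓n≡n b≤a) (m≥n⇒m⊓n≡n d≤c) min≡)

module PathLabels {G : Graph} (code : V G → ℕ) where

  key : V G → V G → ℕ × ℕ
  key u v = code u ⊓ code v , code u ⊔ code v

  key-comm : ∀ u v → key u v ≡ key v u
  key-comm u v = cong₂ _,_ (⊓-comm (code u) (code v)) (⊔-comm (code u) (code v))

  key-injective : Injective _≡_ _≡_ code → ∀ {u v u' v'} → key u v ≡ key u' v' →
                  (u ≡ u' × v ≡ v') ⊎ (u ≡ v' × v ≡ u')
  key-injective code-injective e with minmax-injective (cong proj₁ e) (cong proj₂ e)
  ... | inj₁ (u≡ , v≡) = inj₁ (code-injective u≡ , code-injective v≡)
  ... | inj₂ (u≡ , v≡) = inj₂ (code-injective u≡ , code-injective v≡)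

  module Labelling (label : V G → V G → ℕ × ℕ) where

    Labelled : ∀ {u v} → Path G u v → ℕ × ℕ → Set
    Labelled (p , _) k = All (λ (x , y) → label x y ≡ k × label y x ≡ k) (edges p)

    Connection : V G → V G → Set
    Connection u v = Σ (Path G u v) λ p → Labelled p (key u v)

    labelled⇒disjoint : ∀ {u v u' v' k k'} (p : Path G u v) (q : Path G u' v') →
                        Labelled p k → Labelled q k' → k ≢ k' → EdgeDisjoint p q
    labelled⇒disjoint {k = k} {k'} _ _ p-labelled q-labelled k≢k' a b ab∈p ab∈q = k≢k' (trans (sym labelInP) labelInQ)
      where
      labelInP : label a b ≡ k
      labelInP = proj₁ (All.lookup p-labelled ab∈p)
      labelInQ : label a b ≡ k'
      labelInQ = [ (λ ab∈q → proj₁ (All.lookup q-labelled ab∈q))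
                 , (λ ba∈q → proj₂ (All.lookup q-labelled ba∈q)) ]′ ab∈q

    edgeConnection : ∀ {u v} → Adj G u v → u ≢ v → label u v ≡ key u v → label v u ≡ key u v → Connection u v
    edgeConnection uv u≢v labelled labelled' = (uv ∷ [] , (u≢v ∷ []) ∷ [] ∷ []) , (labelled , labelled') ∷ []

    -- Connections between all pairs of images of an injective map φ form an
    -- immersion: distinct pairs have distinct keys.
    connections⇒immersion : ∀ {t} → Injective _≡_ _≡_ code → (φ : Fin t → V G) → Injective _≡_ _≡_ φ →
                            (∀ i j → i Fin.< j → Connection (φ i) (φ j)) → KImmersion G t
    connections⇒immersion code-injective φ φ-injective connection =
      record { φ = φ ; φ-inj = φ-injective ; path = λ i j i<j → proj₁ (connection i j i<j) ; disj = disjoint }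
      where
      disjoint : ∀ i j k l (i<j : i Fin.< j) (k<l : k Fin.< l) → ¬ (i ≡ k × j ≡ l) →
                 EdgeDisjoint (proj₁ (connection i j i<j)) (proj₁ (connection k l k<l))
      disjoint i j k l i<j k<l ¬same =
        labelled⇒disjoint (proj₁ (connection i j i<j)) (proj₁ (connection k l k<l))
                          (proj₂ (connection i j i<j)) (proj₂ (connection k l k<l)) distinct
        where
        distinct : key (φ i) (φ j) ≢ key (φ k) (φ l)
        distinct e with key-injective code-injective e
        ... | inj₁ (i≡k , j≡l) = ¬same (φ-injective i≡k , φ-injective j≡l)
        ... | inj₂ (i≡l , j≡k) = <-asym i<j (subst₂ Fin._<_ (sym (φ-injective j≡k)) (sym (φ-injective i≡l)) k<l)

quotient-mono : ∀ {k} n {i j : Fin (k * n)} → i Fin.< j → quotient {k} n i Fin.≤ quotient n j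
quotient-mono {k} n {i} {j} i<j with toℕ (quotient {k} n i) ℕ.≤? toℕ (quotient n j)
... | yes q≤q' = q≤q'
... | no  q≰q' = contradiction (subst₂ Fin._<_ (combine-remQuot {k} n j) (combine-remQuot {k} n i) j<i) (<-asym i<j)
  where
  j<i : combine (quotient {k} n j) (remainder {k} n j) Fin.< combine (quotient {k} n i) (remainder {k} n i)
  j<i = combine-monoˡ-< (remainder {k} n j) (remainder {k} n i) (≰⇒> q≰q')

module Ascent {n : ℕ} {H : Graph} (f : ℕ → V H) where

  cell : (p : ℕ) → .(p < n) → V (Lex (Cycle n) H)
  cell p p<n = fromℕ< p<n , f p

  step : ∀ {p} .(p<n : p < n) .(p+1<n : suc p < n) → Adj (Lex (Cycle n) H) (cell p p<n) (cell (suc p) p+1<n)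
  step p<n p+1<n = inj₁ (inj₁ (inj₁ (trans (cong suc (toℕ-fromℕ< p<n)) (sym (toℕ-fromℕ< p+1<n)))))

  ascent : ∀ {p q} (p≤q : p ≤‴ q) .(q<n : q < n) →
           Walk (Lex (Cycle n) H) (cell p (≤-<-trans (≤‴⇒≤ p≤q) q<n)) (cell q q<n)
  ascent ≤‴-refl           _   = []
  ascent (≤‴-step p+1≤q) q<n = step _ _ ∷ ascent p+1≤q q<n

  ascent-edges : ∀ {p q} (P : V (Lex (Cycle n) H) × V (Lex (Cycle n) H) → Set) (p≤q : p ≤‴ q) .(q<n : q < n) →
                 (∀ i .(i<n : i < n) .(i+1<n : suc i < n) → i < q → P (cell i i<n , cell (suc i) i+1<n)) →
                 All P (edges (ascent p≤q q<n))
  ascent-edges P ≤‴-refl           _   _       = []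
  ascent-edges P (≤‴-step p+1≤q) q<n stepsOK = stepsOK _ _ _ (≤‴⇒≤ p+1≤q) ∷ ascent-edges P p+1≤q q<n stepsOK

  ascent-above : ∀ {p q} (p≤q : p ≤‴ q) .(q<n : q < n) →
                 All (λ v → p ≤ toℕ (proj₁ v)) (vertices (ascent p≤q q<n))
  ascent-above ≤‴-refl           _   = ≤-reflexive (sym (toℕ-fromℕ< _)) ∷ []
  ascent-above (≤‴-step p+1≤q) q<n =
    ≤-reflexive (sym (toℕ-fromℕ< _)) ∷ All.map (≤-trans (n≤1+n _)) (ascent-above p+1≤q q<n)

  ascent-unique : ∀ {p q} (p≤q : p ≤‴ q) .(q<n : q < n) → Unique (vertices (ascent p≤q q<n))
  ascent-unique ≤‴-refl           _   = [] ∷ []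
  ascent-unique (≤‴-step p+1≤q) q<n = All.map below (ascent-above p+1≤q q<n) ∷ ascent-unique p+1≤q q<n
    where
    below : ∀ {p} .{p<n : p < n} {v} → suc p ≤ toℕ (proj₁ v) → cell p p<n ≢ v
    below {p} {p<n} p+1≤v refl = 1+n≰n (subst (suc p ≤_) (toℕ-fromℕ< p<n) p+1≤v)

  ascentPath : ∀ {p q} (p≤q : p ≤ q) .(q<n : q < n) → Path (Lex (Cycle n) H) (cell p (≤-<-trans p≤q q<n)) (cell q q<n)
  ascentPath p≤q q<n = ascent (≤⇒≤‴ p≤q) q<n , ascent-unique (≤⇒≤‴ p≤q) q<n

-- A route of length m + 1 from a to c is a sequence
-- route m a c 0 = a, …, route m a c (m + 1) = c in which every consecutive
-- pair determines (a, c).  Odd lengths alternate a, c, a, …, c; even lengths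
-- start a, a ⊕ c, c, which needs the Latin square (a, c) ↦ a ⊕ c of Z/r.
module Routes (r : ℕ) .{{_ : NonZero r}} where

  _⊕_ _⊖_ : Fin r → Fin r → Fin r
  a ⊕ c = (toℕ a + toℕ c) mod r
  y ⊖ x = (toℕ y + (r ∸ toℕ x)) mod r

  ⊕-comm : ∀ a c → a ⊕ c ≡ c ⊕ a
  ⊕-comm a c = cong (_mod r) (+-comm (toℕ a) (toℕ c))

  ⊕-cancel : ∀ a c → (a ⊕ c) ⊖ a ≡ c
  ⊕-cancel a c = toℕ-injective (begin
    toℕ ((a ⊕ c) ⊖ a)                     ≡⟨ toℕ-fromℕ< _ ⟩
    (toℕ (a ⊕ c) + (r ∸ toℕ a)) % r         ≡⟨ cong (λ x → (x + (r ∸ toℕ a)) % r) (toℕ-fromℕ< _) ⟩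
    ((toℕ a + toℕ c) % r + (r ∸ toℕ a)) % r ≡⟨ %-absorbˡ (toℕ a + toℕ c) (r ∸ toℕ a) ⟩
    (toℕ a + toℕ c + (r ∸ toℕ a)) % r       ≡⟨ cong (_% r) rearrange ⟩
    (toℕ c + r) % r                         ≡⟨ [m+n]%n≡m%n (toℕ c) r ⟩
    toℕ c % r                               ≡⟨ m<n⇒m%n≡m (toℕ<n c) ⟩
    toℕ c                                   ∎)
    where
    open ≡-Reasoning
    %-absorbˡ : ∀ x t → (x % r + t) % r ≡ (x + t) % r
    %-absorbˡ x t = begin
      (x % r + t) % r           ≡⟨ %-distribˡ-+ (x % r) t r ⟩
      (x % r % r + t % r) % r   ≡⟨ cong (λ y → (y + t % r) % r) (m%n%n≡m%n x r) ⟩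
      (x % r + t % r) % r       ≡⟨ %-distribˡ-+ x t r ⟨
      (x + t) % r               ∎
    rearrange : toℕ a + toℕ c + (r ∸ toℕ a) ≡ toℕ c + r
    rearrange = begin
      toℕ a + toℕ c + (r ∸ toℕ a)   ≡⟨ cong (_+ (r ∸ toℕ a)) (+-comm (toℕ a) (toℕ c)) ⟩
      toℕ c + toℕ a + (r ∸ toℕ a)   ≡⟨ +-assoc (toℕ c) (toℕ a) (r ∸ toℕ a) ⟩
      toℕ c + (toℕ a + (r ∸ toℕ a)) ≡⟨ cong (toℕ c +_) (m+[n∸m]≡n (<⇒≤ (toℕ<n a))) ⟩
      toℕ c + r                     ∎

  route : ℕ → Fin r → Fin r → ℕ → Fin r
  route _             a _ zero          = a
  route zero          _ c (suc _)       = c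
  route (suc zero)    a c (suc zero)    = a ⊕ c
  route (suc zero)    _ c (suc (suc _)) = c
  route (suc (suc _)) _ c (suc zero)    = c
  route (suc (suc m)) a c (suc (suc p)) = route m a c p

  unroute : ℕ → ℕ → Fin r → Fin r → Fin r × Fin r
  unroute zero          _             x y = x , y
  unroute (suc zero)    zero          x y = x , y ⊖ x
  unroute (suc zero)    (suc _)       x y = x ⊖ y , y
  unroute (suc (suc _)) zero          x y = x , y
  unroute (suc (suc _)) (suc zero)    x y = y , x
  unroute (suc (suc m)) (suc (suc p)) x y = unroute m p x y

  route-end : ∀ m a c → route m a c (suc m) ≡ c
  route-end zero          a c = refl
  route-end (suc zero)    a c = refl
  route-end (suc (suc m)) a c = route-end m a c

  unroute-route : ∀ m p a c → p ≤ m → unroute m p (route m a c p) (route m a c (suc p)) ≡ (a , c)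
  unroute-route zero          zero          a c _ = refl
  unroute-route (suc zero)    zero          a c _ = cong (a ,_) (⊕-cancel a c)
  unroute-route (suc zero)    (suc zero)    a c _ = cong (_, c) (trans (cong (_⊖ c) (⊕-comm a c)) (⊕-cancel c a))
  unroute-route (suc zero)    (suc (suc _)) _ _ (s≤s ())
  unroute-route (suc (suc m)) zero          a c _ = refl
  unroute-route (suc (suc m)) (suc zero)    a c _ = refl
  unroute-route (suc (suc m)) (suc (suc p)) a c (s≤s (s≤s p≤m)) = unroute-route m p a c p≤m

module Construction (m r' : ℕ) where

  N n r : ℕ
  N = suc m
  n = suc (suc N)
  r = suc r'

  G : Graph
  G = Lex (Cycle n) (Complete r)

  open Routes r using (route; unroute; route-end; unroute-route)

  height : Fin 3 → ℕ
  height 0F = 0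
  height 1F = N
  height 2F = suc N

  height<n : ∀ L → height L < n
  height<n 0F = s≤s z≤n
  height<n 1F = s≤s (n≤1+n N)
  height<n 2F = n<1+n (suc N)

  height-injective : ∀ {L L'} → height L ≡ height L' → L ≡ L'
  height-injective {0F} {0F} _  = refl
  height-injective {1F} {1F} _  = refl
  height-injective {2F} {2F} _  = refl
  height-injective {0F} {1F} ()
  height-injective {0F} {2F} ()
  height-injective {1F} {0F} ()
  height-injective {2F} {0F} ()
  height-injective {1F} {2F} e  = ⊥-elim (<-irrefl e (n<1+n N))
  height-injective {2F} {1F} e  = ⊥-elim (<-irrefl (sym e) (n<1+n N))

  layer : Fin 3 → Fin n
  layer L = fromℕ< (height<n L)

  toℕ-layer : ∀ L → toℕ (layer L) ≡ height L
  toℕ-layer L = toℕ-fromℕ< (height<n L)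

  terminal : Fin 3 → Fin r → V G
  terminal L h = layer L , h

  terminal-injective : ∀ {L h L' h'} → terminal L h ≡ terminal L' h' → (L , h) ≡ (L' , h')
  terminal-injective {L} {L' = L'} e =
    cong₂ _,_ (height-injective (subst₂ _≡_ (toℕ-layer L) (toℕ-layer L') (cong (toℕ ∘ proj₁) e))) (cong proj₂ e)

  φ : Fin (3 * r) → V G
  φ i = terminal (quotient {3} r i) (remainder {3} r i)

  φ-injective : Injective _≡_ _≡_ φ
  φ-injective {i} {j} e = begin
    i                                    ≡⟨ combine-remQuot {3} r i ⟨
    uncurry combine (remQuot {3} r i)    ≡⟨ cong (uncurry combine) (terminal-injective e) ⟩
    uncurry combine (remQuot {3} r j)    ≡⟨ combine-remQuot {3} r j ⟩
    j                                    ∎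
    where open ≡-Reasoning

  code : V G → ℕ
  code (g , h) = toℕ (combine g h)

  code-injective : Injective _≡_ _≡_ code
  code-injective {g , h} {g' , h'} e with combine-injective g h g' h' (toℕ-injective e)
  ... | refl , refl = refl

  open PathLabels {G} code using (key; key-comm)

  ArcStep : ℕ → ℕ → Set
  ArcStep p q = suc p ≡ q × q ≤ N

  arcStep? : ∀ p q → Dec (ArcStep p q)
  arcStep? p q = (suc p ℕ.≟ q) ×-dec (q ℕ.≤? N)

  ArcStep-irreflexive : ∀ {p} → ¬ ArcStep p p
  ArcStep-irreflexive (p+1≡p , _) = 1+n≰n (≤-reflexive p+1≡p)

  ArcStep-asymmetric : ∀ {p q} → ArcStep p q → ¬ ArcStep q p
  ArcStep-asymmetric (p+1≡q , _) (q+1≡p , _) = <-asym (≤-reflexive p+1≡q) (≤-reflexive q+1≡p)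

  arcPairKey : Fin r × Fin r → ℕ × ℕ
  arcPairKey (a , c) = key (terminal 0F a) (terminal 1F c)

  arcKey : ℕ → Fin r → Fin r → ℕ × ℕ
  arcKey p x y = arcPairKey (unroute m p x y)

  -- arc edges are labelled by the pair their step determines, all other
  -- edges by their own ends
  label : V G → V G → ℕ × ℕ
  label (g , x) (g' , y) with arcStep? (toℕ g) (toℕ g') | arcStep? (toℕ g') (toℕ g)
  ... | yes _ | _     = arcKey (toℕ g) x y
  ... | no _  | yes _ = arcKey (toℕ g') y x
  ... | no _  | no _  = key (g , x) (g' , y)

  open PathLabels.Labelling {G} code label

  label-forward : ∀ {g g' x y} → ArcStep (toℕ g) (toℕ g') → label (g , x) (g' , y) ≡ arcKey (toℕ g) x y
  label-forward {g} {g'} s with arcStep? (toℕ g) (toℕ g')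
  ... | yes _ = refl
  ... | no ¬s = contradiction s ¬s

  label-backward : ∀ {g g' x y} → ArcStep (toℕ g') (toℕ g) → label (g , x) (g' , y) ≡ arcKey (toℕ g') y x
  label-backward {g} {g'} s with arcStep? (toℕ g) (toℕ g') | arcStep? (toℕ g') (toℕ g)
  ... | yes s'  | _     = contradiction s (ArcStep-asymmetric s')
  ... | no _    | yes _ = refl
  ... | no _    | no ¬s = contradiction s ¬s

  label-plain : ∀ {g g' x y} → ¬ ArcStep (toℕ g) (toℕ g') → ¬ ArcStep (toℕ g') (toℕ g) →
                label (g , x) (g' , y) ≡ key (g , x) (g' , y)
  label-plain {g} {g'} ¬s ¬s' with arcStep? (toℕ g) (toℕ g') | arcStep? (toℕ g') (toℕ g)
  ... | yes s | _     = contradiction s ¬s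
  ... | no _  | yes s = contradiction s ¬s'
  ... | no _  | no _  = refl

  different-layers : ∀ {L h L' h'} → L ≢ L' → terminal L h ≢ terminal L' h'
  different-layers L≢L' = L≢L' ∘ cong proj₁ ∘ terminal-injective

  directConnection : ∀ {L h L' h'} → Adj G (terminal L h) (terminal L' h') → terminal L h ≢ terminal L' h' →
                     ¬ ArcStep (height L) (height L') → ¬ ArcStep (height L') (height L) →
                     Connection (terminal L h) (terminal L' h')
  directConnection {L} {h} {L'} {h'} adj distinct ¬s ¬s' =
    edgeConnection adj distinct (label-plain (onLayers ¬s) (onLayers ¬s'))
                   (trans (label-plain (onLayers ¬s') (onLayers ¬s)) (key-comm (terminal L' h') (terminal L h)))
    where
    onLayers : ∀ {K K'} → ¬ ArcStep (height K) (height K') → ¬ ArcStep (toℕ (layer K)) (toℕ (layer K'))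
    onLayers {K} {K'} ¬s = ¬s ∘ subst₂ ArcStep (toℕ-layer K) (toℕ-layer K')

  sameLayer : ∀ L {h h'} → terminal L h ≢ terminal L h' → Connection (terminal L h) (terminal L h')
  sameLayer L {h} {h'} distinct =
    directConnection {L} {h} {L} {h'} (inj₂ (refl , distinct ∘ cong (terminal L))) distinct
                     ArcStep-irreflexive ArcStep-irreflexive

  wrapConnection : ∀ h h' → Connection (terminal 0F h) (terminal 2F h')
  wrapConnection h h' =
    directConnection {0F} {h} {2F} {h'} (inj₁ (inj₁ (inj₂ (refl , cong suc (toℕ-layer 2F)))))
                     (different-layers {0F} {h} {2F} {h'} λ ()) (λ { (() , _) }) (λ { (() , _) })

  topConnection : ∀ h h' → Connection (terminal 1F h) (terminal 2F h')
  topConnection h h' =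
    directConnection {1F} {h} {2F} {h'} (inj₁ (inj₁ (inj₁ (trans (cong suc (toℕ-layer 1F)) (sym (toℕ-layer 2F))))))
                     (different-layers {1F} {h} {2F} {h'} λ ())
                     (λ (_ , N+1≤N) → 1+n≰n N+1≤N)
                     (λ (N+2≡N , _) → 1+n≰n (≤-trans (n≤1+n _) (≤-reflexive N+2≡N)))

  -- a in layer 0 and c in layer N are connected by the ascent along route m a c;
  -- each of its edges determines (a, c) through unroute
  arcConnection : ∀ a c → Connection (terminal 0F a) (terminal 1F c)
  arcConnection a c = subst (λ z → Σ (Path G (terminal 0F a) (layer 1F , z)) λ p → Labelled p arcKeyOf)
                            (route-end m a c)
                            (ascentPath z≤n (height<n 1F) , ascent-edges _ (≤⇒≤‴ z≤n) (height<n 1F) arcEdge)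
    where
    open Ascent {n} {Complete r} (route m a c)

    arcKeyOf : ℕ × ℕ
    arcKeyOf = arcPairKey (a , c)

    arcEdge : ∀ i .(i<n : i < n) .(i+1<n : suc i < n) → i < N →
              label (cell i i<n) (cell (suc i) i+1<n) ≡ arcKeyOf × label (cell (suc i) i+1<n) (cell i i<n) ≡ arcKeyOf
    arcEdge i i<n i+1<n (s≤s i≤m) = trans (label-forward isStep) onArc , trans (label-backward isStep) onArc
      where
      isStep : ArcStep (toℕ (fromℕ< i<n)) (toℕ (fromℕ< i+1<n))
      isStep = trans (cong suc (toℕ-fromℕ< i<n)) (sym (toℕ-fromℕ< i+1<n)) ,
               subst (_≤ N) (sym (toℕ-fromℕ< i+1<n)) (s≤s i≤m)

      onArc : arcKey (toℕ (fromℕ< i<n)) (route m a c i) (route m a c (suc i)) ≡ arcKeyOf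
      onArc = trans (cong (λ p → arcKey p (route m a c i) (route m a c (suc i))) (toℕ-fromℕ< i<n))
                    (cong arcPairKey (unroute-route m i a c i≤m))

  connect : ∀ L h L' h' → L Fin.≤ L' → terminal L h ≢ terminal L' h' → Connection (terminal L h) (terminal L' h')
  connect 0F h 0F h' _ distinct = sameLayer 0F distinct
  connect 1F h 1F h' _ distinct = sameLayer 1F distinct
  connect 2F h 2F h' _ distinct = sameLayer 2F distinct
  connect 0F h 1F h' _ _        = arcConnection h h'
  connect 0F h 2F h' _ _        = wrapConnection h h'
  connect 1F h 2F h' _ _        = topConnection h h'
  connect 1F _ 0F _  ()
  connect 2F _ 0F _  ()
  connect 2F _ 1F _  (s≤s ())

  immersion : KImmersion G (3 * r)
  immersion = connections⇒immersion code-injective φ φ-injective λ i j i<j →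
    connect _ _ _ _ (quotient-mono {3} r i<j) (<⇒≢ i<j ∘ φ-injective)

corollary7 : (n r : ℕ) → 3 ≤ n → 1 ≤ r →
    ImmersionNumber (Lex (Cycle n) (Complete r)) (3 * r)
corollary7 (suc (suc (suc m))) (suc r') _ _ = Construction.immersion m r' , λ s → cycleLex-bound _ r' s
corollary7 0                   _        () _
corollary7 1                   _        (s≤s ()) _
corollary7 2                   _        (s≤s (s≤s ())) _
corollary7 _                   0        _ ()
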